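{- For each prime integer $n$ and each integer $k$ with $1\le k<n$, $\left(\begin{array}{c} n\\ n\end{array}\right)\not\rightarrow\left(\begin{array}{c} 2\\ k\end{array}\right)^{1,1}_{n,k}$; that is, there is a function $h:n\times n\to n$ such that for all $a\in[n]^k$ and $b\in[n]^2$ the restriction $h\restriction a\times b$ takes more than $k$ values.
   Context: Integers are identified with sets $n=\{0,\dots,n-1\}$, and $[X]^r$ denotes the set of $r$-element subsets of $X$. The symbol $\left(\begin{array}{c} m\\ n\end{array}\right)\not\rightarrow\left(\begin{array}{c} j\\ i\end{array}\right)^{1,1}_{k,q}$ means there is a function $h:n\times m\to k$ such that for all $a\in[n]^i$ and $b\in[m]^j$, $h\restriction a\times b$ takes more than $q$ values. -}

module Defs where

open import Data.Nat using (ℕ; _<_)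
open import Data.Fin using (Fin)
open import Data.Fin.Subset using (Subset; _∈_; ∣_∣)
open import Data.Product using (Σ; ∃; _×_; _,_)
open import Relation.Binary.PropositionalEquality using (_≡_)
open import Relation.Nullary using (¬_)

[_]^_ : ℕ → ℕ → Set
[ n ]^ r = Σ (Subset n) λ a → ∣ a ∣ ≡ r

Attained : ∀ {n m k} → (Fin n → Fin m → Fin k) → Subset n → Subset m → Fin k → Set
Attained h a b c = ∃ λ x → ∃ λ y → x ∈ a × y ∈ b × h x y ≡ c

MoreThanValues : ∀ {n m k} → (Fin n → Fin m → Fin k) → Subset n → Subset m → ℕ → Set
MoreThanValues {k = k} h a b q =
  ∃ λ (S : Subset k) → q < ∣ S ∣ × (∀ c → c ∈ S → Attained h a b c)

-- (m over n) ↛ (j over i)^{1,1}_{k,q}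
NotArrow : (m n j i k q : ℕ) → Set
NotArrow m n j i k q =
  ∃ λ (h : Fin n → Fin m → Fin k) →
    (a : [ n ]^ i) → (b : [ m ]^ j) →
      MoreThanValues h (Σ.proj₁ a) (Σ.proj₁ b) q

-- Colour (x, y) by x − y (mod n).  On a × {y} the colours are the translate a − y, of size k,
-- so on a × {y₁, y₂} there are at most k colours only if a − y₁ ⊆ a − y₂, i.e. a is closed
-- under adding d = y₂ − y₁.  As n is prime, d is invertible mod n, so a is closed under
-- adding 1 and, being nonempty, is all of n, contradicting k < n.

module Submission where

open import Defs

open import Data.Bool using (Bool; true; false; if_then_else_)
open import Data.Fin using (Fin; zero; suc; toℕ; fromℕ<)
open import Data.Fin.Permutation using (Permutation; permutation; _⟨$⟩ʳ_)
open import Data.Fin.Properties using (toℕ-fromℕ<; toℕ-injective; toℕ<n; fromℕ<-cong; any?; <-cmp)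
open import Data.Fin.Subset using (Subset; _∈_; _∉_; _⊆_; _∪_; ∣_∣; ⊥; ⊤; Nonempty)
open import Data.Fin.Subset.Properties
  using (_∈?_; p⊆q⇒∣p∣≤∣q∣; p⊂q⇒∣p∣<∣q∣; q⊆p∪q; x∈p∪q⁺; x∈p∪q⁻; ∣⊥∣≡0; ∣⊤∣≡n; ∣⁅x⁆∣≡1; x∉⁅y⁆⇒x≢y)
open import Data.Nat using (ℕ; zero; suc; _+_; _*_; _∸_; _≤_; _<_; z<s; NonZero; >-nonZero)
open import Data.Nat.Coprimality using (prime⇒coprime; coprime-Bézout)
open import Data.Nat.DivMod using (_%_; m%n<n; %-distribˡ-+; m%n%n≡m%n; m<n⇒m%n≡m; [m+n]%n≡m%n; [m+kn]%n≡m%n)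
open import Data.Nat.GCD using (module Bézout)
open import Data.Nat.Primality using (Prime; prime⇒nonZero)
open import Data.Nat.Properties hiding (<-cmp)
open import Algebra.Properties.CommutativeMonoid.Sum +-0-commutativeMonoid using (∑-permute; sum-syntax)
open import Data.Nat.Tactic.RingSolver using (solve)
open import Data.List using ([]; _∷_)
open import Data.Product using (∃; ∃₂; _×_; _,_)
open import Data.Sum using (inj₁; [_,_]′)
open import Function using (_∘_)
open import Data.Vec using (lookup; tabulate)
open import Data.Vec.Properties using (lookup∘tabulate; tabulate∘lookup; []=⇒lookup; lookup⇒[]=)
open import Relation.Binary using (tri<; tri≈; tri>)
open import Relation.Binary.PropositionalEquality
open import Relation.Nullary using (¬_; yes; no; contradiction)
open import Relation.Nullary.Decidable using (_×-dec_; ¬?; decidable-stable)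

open ≡-Reasoning

module _ {n : ℕ} {p q : Subset n} where

  ⊈⇒∃∈∉ : ¬ (p ⊆ q) → ∃ λ x → x ∈ p × x ∉ q
  ⊈⇒∃∈∉ p⊈q with any? (λ x → x ∈? p ×-dec ¬? (x ∈? q))
  ... | yes witness = witness
  ... | no ∄ = contradiction (λ {x} x∈p → decidable-stable (x ∈? q) (λ x∉q → ∄ (x , x∈p , x∉q))) p⊈q

  ∣q∣<∣p∣⇒∃∈∉ : ∣ q ∣ < ∣ p ∣ → ∃ λ x → x ∈ p × x ∉ q
  ∣q∣<∣p∣⇒∃∈∉ ∣q∣<∣p∣ = ⊈⇒∃∈∉ (λ p⊆q → <⇒≱ ∣q∣<∣p∣ (p⊆q⇒∣p∣≤∣q∣ p⊆q))

  ⊈⇒∣q∣<∣p∪q∣ : ¬ (p ⊆ q) → ∣ q ∣ < ∣ p ∪ q ∣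
  ⊈⇒∣q∣<∣p∪q∣ p⊈q with ⊈⇒∃∈∉ p⊈q
  ... | x , x∈p , x∉q = p⊂q⇒∣p∣<∣q∣ (q⊆p∪q p q , x , x∈p∪q⁺ (inj₁ x∈p) , x∉q)

module _ {n : ℕ} {p : Subset n} where

  0<∣p∣⇒nonempty : 0 < ∣ p ∣ → Nonempty p
  0<∣p∣⇒nonempty 0<∣p∣ with ∣q∣<∣p∣⇒∃∈∉ {q = ⊥} (subst (_< ∣ p ∣) (sym (∣⊥∣≡0 n)) 0<∣p∣)
  ... | x , x∈p , _ = x , x∈p

  1<∣p∣⇒∃< : 1 < ∣ p ∣ → ∃₂ λ x y → toℕ x < toℕ y × x ∈ p × y ∈ p
  1<∣p∣⇒∃< 1<∣p∣ with 0<∣p∣⇒nonempty (<-trans z<s 1<∣p∣)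
  ... | x , x∈p with ∣q∣<∣p∣⇒∃∈∉ (subst (_< ∣ p ∣) (sym (∣⁅x⁆∣≡1 x)) 1<∣p∣)
  ... | y , y∈p , y∉⁅x⁆ with <-cmp x y
  ... | tri< x<y _ _ = x , y , x<y , x∈p , y∈p
  ... | tri≈ _ x≡y _ = contradiction (sym x≡y) (x∉⁅y⁆⇒x≢y y∉⁅x⁆)
  ... | tri> _ _ y<x = y , x , y<x , y∈p , x∈p

∣tabulate∣≡∑ : ∀ {n} (f : Fin n → Bool) → ∣ tabulate f ∣ ≡ ∑[ i < n ] (if f i then 1 else 0)
∣tabulate∣≡∑ {zero}  f = refl
∣tabulate∣≡∑ {suc n} f with f zero
... | true  = cong suc (∣tabulate∣≡∑ (f ∘ suc))
... | false = ∣tabulate∣≡∑ (f ∘ suc)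

preimage : ∀ {m n} → (Fin m → Fin n) → Subset n → Subset m
preimage f p = tabulate (λ i → lookup p (f i))

module _ {m n} {f : Fin m → Fin n} {p : Subset n} {i : Fin m} where

  ∈-preimage⁺ : f i ∈ p → i ∈ preimage f p
  ∈-preimage⁺ fi∈p = lookup⇒[]= i (preimage f p) (trans (lookup∘tabulate _ i) ([]=⇒lookup fi∈p))

  ∈-preimage⁻ : i ∈ preimage f p → f i ∈ p
  ∈-preimage⁻ i∈f⁻¹p = lookup⇒[]= (f i) p (trans (sym (lookup∘tabulate _ i)) ([]=⇒lookup i∈f⁻¹p))

∣preimage∣≡∣p∣ : ∀ {m n} (π : Permutation m n) (p : Subset n) → ∣ preimage (π ⟨$⟩ʳ_) p ∣ ≡ ∣ p ∣
∣preimage∣≡∣p∣ {m} {n} π p = begin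
  ∣ preimage (π ⟨$⟩ʳ_) p ∣                     ≡⟨ ∣tabulate∣≡∑ (λ i → lookup p (π ⟨$⟩ʳ i)) ⟩
  ∑[ i < m ] (if lookup p (π ⟨$⟩ʳ i) then 1 else 0) ≡⟨ ∑-permute (λ i → if lookup p i then 1 else 0) π ⟨
  ∑[ i < n ] (if lookup p i then 1 else 0)       ≡⟨ ∣tabulate∣≡∑ (lookup p) ⟨
  ∣ tabulate (lookup p) ∣                        ≡⟨ cong ∣_∣ (tabulate∘lookup p) ⟩
  ∣ p ∣                                          ∎

inverse-mod-prime : ∀ {p d} .{{_ : NonZero p}} .{{_ : NonZero d}} → Prime p → d < p →
                    ∃ λ t → t * d % p ≡ 1 % p
inverse-mod-prime {suc m} {d} pr d<p with coprime-Bézout (prime⇒coprime pr d<p)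
... | Bézout.-+ x y 1+xp≡yd = y , (begin
  y * d % suc m             ≡⟨ cong (_% suc m) 1+xp≡yd ⟨
  (1 + x * suc m) % suc m   ≡⟨ [m+kn]%n≡m%n 1 x (suc m) ⟩
  1 % suc m                 ∎)
... | Bézout.+- x y 1+yd≡xp = m * y , (begin
  m * y * d % suc m                 ≡⟨ [m+n]%n≡m%n (m * y * d) (suc m) ⟨
  (m * y * d + suc m) % suc m       ≡⟨ cong (_% suc m) (multiply 1+yd≡xp) ⟩
  (1 + m * x * suc m) % suc m       ≡⟨ [m+kn]%n≡m%n 1 (m * x) (suc m) ⟩
  1 % suc m                         ∎)
  where
  -- m ≡ -1 (mod p), so y d ≡ -1 gives (m y) d ≡ 1
  multiply : 1 + y * d ≡ x * suc m → m * y * d + suc m ≡ 1 + m * x * suc m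
  multiply eq = begin
    m * y * d + suc m         ≡⟨ solve (m ∷ y ∷ d ∷ []) ⟩
    1 + m * (1 + y * d)       ≡⟨ cong (λ r → 1 + m * r) eq ⟩
    1 + m * (x * suc m)       ≡⟨ cong (1 +_) (*-assoc m x (suc m)) ⟨
    1 + m * x * suc m         ∎

module _ {n : ℕ} .{{_ : NonZero n}} where

  infixl 6 _⊕_ _⊖_

  _⊕_ : Fin n → ℕ → Fin n
  i ⊕ j = fromℕ< (m%n<n (toℕ i + j) n)

  _⊖_ : Fin n → Fin n → Fin n
  i ⊖ y = i ⊕ (n ∸ toℕ y)

  ⊕-≡ : ∀ i j i′ j′ → (toℕ i + j) % n ≡ (toℕ i′ + j′) % n → i ⊕ j ≡ i′ ⊕ j′
  ⊕-≡ _ _ _ _ eq = fromℕ<-cong _ _ eq _ _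

  ⊕-congˡ : ∀ i {j l} → j % n ≡ l % n → i ⊕ j ≡ i ⊕ l
  ⊕-congˡ i {j} {l} j≡l = ⊕-≡ i j i l (begin
    (toℕ i + j) % n            ≡⟨ %-distribˡ-+ (toℕ i) j n ⟩
    (toℕ i % n + j % n) % n    ≡⟨ cong (λ r → (toℕ i % n + r) % n) j≡l ⟩
    (toℕ i % n + l % n) % n    ≡⟨ %-distribˡ-+ (toℕ i) l n ⟨
    (toℕ i + l) % n            ∎)

  ⊕-assoc : ∀ i j l → i ⊕ j ⊕ l ≡ i ⊕ (j + l)
  ⊕-assoc i j l = ⊕-≡ (i ⊕ j) l i (j + l) (begin
    (toℕ (i ⊕ j) + l) % n               ≡⟨ cong (λ r → (r + l) % n) (toℕ-fromℕ< _) ⟩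
    ((toℕ i + j) % n + l) % n           ≡⟨ %-distribˡ-+ ((toℕ i + j) % n) l n ⟩
    ((toℕ i + j) % n % n + l % n) % n   ≡⟨ cong (λ r → (r + l % n) % n) (m%n%n≡m%n (toℕ i + j) n) ⟩
    ((toℕ i + j) % n + l % n) % n       ≡⟨ %-distribˡ-+ (toℕ i + j) l n ⟨
    (toℕ i + j + l) % n                 ≡⟨ cong (_% n) (+-assoc (toℕ i) j l) ⟩
    (toℕ i + (j + l)) % n               ∎)

  ⊕-identityʳ : ∀ i → i ⊕ 0 ≡ i
  ⊕-identityʳ i = toℕ-injective (begin
    toℕ (i ⊕ 0)       ≡⟨ toℕ-fromℕ< _ ⟩
    (toℕ i + 0) % n   ≡⟨ cong (_% n) (+-identityʳ (toℕ i)) ⟩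
    toℕ i % n         ≡⟨ m<n⇒m%n≡m (toℕ<n i) ⟩
    toℕ i             ∎)

  ⊕-n : ∀ i → i ⊕ n ≡ i
  ⊕-n i = begin
    i ⊕ n   ≡⟨ ⊕-≡ i n i 0 (trans ([m+n]%n≡m%n (toℕ i) n) (cong (_% n) (sym (+-identityʳ (toℕ i))))) ⟩
    i ⊕ 0   ≡⟨ ⊕-identityʳ i ⟩
    i       ∎

  ⊖-⊕-cancel : ∀ i y → i ⊖ y ⊕ toℕ y ≡ i
  ⊖-⊕-cancel i y = begin
    i ⊖ y ⊕ toℕ y              ≡⟨ ⊕-assoc i (n ∸ toℕ y) (toℕ y) ⟩
    i ⊕ (n ∸ toℕ y + toℕ y)    ≡⟨ cong (i ⊕_) (m∸n+n≡m (<⇒≤ (toℕ<n y))) ⟩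
    i ⊕ n                      ≡⟨ ⊕-n i ⟩
    i                          ∎

  ⊕-⊖-cancel : ∀ i y → i ⊕ toℕ y ⊖ y ≡ i
  ⊕-⊖-cancel i y = begin
    i ⊕ toℕ y ⊖ y              ≡⟨ ⊕-assoc i (toℕ y) (n ∸ toℕ y) ⟩
    i ⊕ (toℕ y + (n ∸ toℕ y))  ≡⟨ cong (i ⊕_) (m+[n∸m]≡n (<⇒≤ (toℕ<n y))) ⟩
    i ⊕ n                      ≡⟨ ⊕-n i ⟩
    i                          ∎

  ⊕-surjective : ∀ i w → ∃ λ j → i ⊕ j ≡ w
  ⊕-surjective i w = j , (begin
    i ⊕ j   ≡⟨ ⊕-≡ i j w n (cong (_% n) i+j≡w+n) ⟩
    w ⊕ n   ≡⟨ ⊕-n w ⟩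
    w       ∎)
    where
    j : ℕ
    j = n ∸ toℕ i + toℕ w
    i+j≡w+n : toℕ i + j ≡ toℕ w + n
    i+j≡w+n = begin
      toℕ i + (n ∸ toℕ i + toℕ w)   ≡⟨ +-assoc (toℕ i) (n ∸ toℕ i) (toℕ w) ⟨
      toℕ i + (n ∸ toℕ i) + toℕ w   ≡⟨ cong (_+ toℕ w) (m+[n∸m]≡n (<⇒≤ (toℕ<n i))) ⟩
      n + toℕ w                     ≡⟨ +-comm n (toℕ w) ⟩
      toℕ w + n                     ∎

  translation : Fin n → Permutation n n
  translation y = permutation (_⊕ toℕ y) (_⊖ y) (λ i → ⊖-⊕-cancel i y) (λ i → ⊕-⊖-cancel i y)

  ShiftClosed : ℕ → Subset n → Set
  ShiftClosed d p = ∀ {x} → x ∈ p → x ⊕ d ∈ p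

module _ {n : ℕ} .{{_ : NonZero n}} {p : Subset n} where

  shiftClosed-* : ∀ {d} → ShiftClosed d p → ∀ t → ShiftClosed (t * d) p
  shiftClosed-* cl zero    {x} x∈p = subst (_∈ p) (sym (⊕-identityʳ x)) x∈p
  shiftClosed-* {d} cl (suc t) {x} x∈p = subst (_∈ p) (⊕-assoc x d (t * d)) (shiftClosed-* cl t (cl x∈p))

  shiftClosed-% : ∀ {j l} → j % n ≡ l % n → ShiftClosed j p → ShiftClosed l p
  shiftClosed-% j≡l cl {x} x∈p = subst (_∈ p) (⊕-congˡ x j≡l) (cl x∈p)

  shiftClosed-prime : Prime n → ∀ {d} .{{_ : NonZero d}} → d < n → ShiftClosed d p → ShiftClosed 1 p
  shiftClosed-prime pr d<n cl with inverse-mod-prime pr d<n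
  ... | t , td≡1 = shiftClosed-% td≡1 (shiftClosed-* cl t)

  shiftClosed-1⇒⊤⊆ : ShiftClosed 1 p → Nonempty p → ⊤ ⊆ p
  shiftClosed-1⇒⊤⊆ cl (x , x∈p) {w} _ with ⊕-surjective x w
  ... | j , x⊕j≡w = subst (_∈ p) (trans (cong (x ⊕_) (*-identityʳ j)) x⊕j≡w) (shiftClosed-* cl j x∈p)

  preimage-⊆⇒shiftClosed : ∀ (y : Fin n) d {l} → toℕ y + d ≡ l →
                           preimage (_⊕ toℕ y) p ⊆ preimage (_⊕ l) p → ShiftClosed d p
  preimage-⊆⇒shiftClosed y d {l} y+d≡l ⊆ {x} x∈p = subst (_∈ p) x⊖y⊕l≡x⊕d (∈-preimage⁻ (⊆ x⊖y∈))
    where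
    x⊖y∈ : x ⊖ y ∈ preimage (_⊕ toℕ y) p
    x⊖y∈ = ∈-preimage⁺ (subst (_∈ p) (sym (⊖-⊕-cancel x y)) x∈p)
    x⊖y⊕l≡x⊕d : x ⊖ y ⊕ l ≡ x ⊕ d
    x⊖y⊕l≡x⊕d = begin
      x ⊖ y ⊕ l               ≡⟨ cong (x ⊖ y ⊕_) y+d≡l ⟨
      x ⊖ y ⊕ (toℕ y + d)     ≡⟨ ⊕-assoc (x ⊖ y) (toℕ y) d ⟨
      x ⊖ y ⊕ toℕ y ⊕ d       ≡⟨ cong (_⊕ d) (⊖-⊕-cancel x y) ⟩
      x ⊕ d                   ∎

  preimage-⊈ : Prime n → Nonempty p → ∣ p ∣ < n → ∀ {y₁ y₂ : Fin n} → toℕ y₁ < toℕ y₂ →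
               ¬ (preimage (_⊕ toℕ y₁) p ⊆ preimage (_⊕ toℕ y₂) p)
  preimage-⊈ pr p≢∅ ∣p∣<n {y₁} {y₂} y₁<y₂ ⊆ = <⇒≱ ∣p∣<n
    (subst (_≤ ∣ p ∣) (∣⊤∣≡n n) (p⊆q⇒∣p∣≤∣q∣ (shiftClosed-1⇒⊤⊆ (shiftClosed-prime pr d<n closed) p≢∅)))
    where
    d : ℕ
    d = toℕ y₂ ∸ toℕ y₁
    instance
      d≢0 : NonZero d
      d≢0 = >-nonZero (m<n⇒0<n∸m y₁<y₂)
    d<n : d < n
    d<n = ≤-<-trans (m∸n≤m (toℕ y₂) (toℕ y₁)) (toℕ<n y₂)
    closed : ShiftClosed d p
    closed = preimage-⊆⇒shiftClosed y₁ d (m+[n∸m]≡n (<⇒≤ y₁<y₂)) ⊆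

module _ {n : ℕ} .{{_ : NonZero n}} {a b : Subset n} where

  ⊖-attains : ∀ {y c} → y ∈ b → c ∈ preimage (_⊕ toℕ y) a → Attained _⊖_ a b c
  ⊖-attains {y} {c} y∈b c∈ = c ⊕ toℕ y , y , ∈-preimage⁻ c∈ , y∈b , ⊕-⊖-cancel c y

  ⊖-moreThanValues : Prime n → 0 < ∣ a ∣ → ∣ a ∣ < n → 1 < ∣ b ∣ → MoreThanValues _⊖_ a b ∣ a ∣
  ⊖-moreThanValues pr 0<∣a∣ ∣a∣<n 1<∣b∣ with 1<∣p∣⇒∃< 1<∣b∣
  ... | y₁ , y₂ , y₁<y₂ , y₁∈b , y₂∈b = a₁ ∪ a₂ , ∣a∣<∣a₁∪a₂∣ , attained
    where
    a₁ a₂ : Subset n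
    a₁ = preimage (_⊕ toℕ y₁) a
    a₂ = preimage (_⊕ toℕ y₂) a
    ∣a∣<∣a₁∪a₂∣ : ∣ a ∣ < ∣ a₁ ∪ a₂ ∣
    ∣a∣<∣a₁∪a₂∣ = subst (_< ∣ a₁ ∪ a₂ ∣) (∣preimage∣≡∣p∣ (translation y₂) a)
      (⊈⇒∣q∣<∣p∪q∣ (preimage-⊈ {p = a} pr (0<∣p∣⇒nonempty 0<∣a∣) ∣a∣<n y₁<y₂))
    attained : ∀ c → c ∈ a₁ ∪ a₂ → Attained _⊖_ a b c
    attained c c∈ = [ ⊖-attains y₁∈b , ⊖-attains y₂∈b ]′ (x∈p∪q⁻ a₁ a₂ c∈)

lemma3p3 : (n : ℕ) → Prime n → (k : ℕ) → 1 ≤ k → k < n → NotArrow n n 2 k n k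
lemma3p3 n pr k 1≤k k<n = _⊖_ , λ (a , ∣a∣≡k) (b , ∣b∣≡2) →
  subst (MoreThanValues _⊖_ a b) ∣a∣≡k
    (⊖-moreThanValues pr (≤-trans 1≤k (≤-reflexive (sym ∣a∣≡k))) (subst (_< n) (sym ∣a∣≡k) k<n)
      (≤-reflexive (sym ∣b∣≡2)))
  where
  instance
    n≢0 : NonZero n
    n≢0 = prime⇒nonZero pr
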